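{- Let $r\in\mathbb N$. Then there exist an integer $k=k(r)$ and a binary relation $A\subseteq\mathrm{atp}^{k+1}\times\mathrm{atp}^{k+1}$ such that for every undirected graph $G$, \[\mathrm{LowRank}^r(G)=\bigcup_{\bar a\in V(G)^k}\mathrm{Suffixes}(G\oplus_{\bar a}A).\]
   Context: Graphs are finite, simple, undirected, vertex-colored with a fixed finite set of unary predicates. $\mathrm{rk}(X)$ is the rank over $\mathbb F_2$ of the adjacency matrix between $X$ and $V(G)\setminus X$; $\mathrm{LowRank}^r(G)=\{X\subseteq V(G):\mathrm{rk}(X)\le r\}$. Atomic type $\mathrm{atp}(v_1,\dots,v_k)$: set of atomic formulas $x_i=x_j$, $E(x_i,x_j)$, $U(x_i)$ satisfied; $\mathrm{atp}^k$: all atomic types of $k$-tuples. For $\bar a\in V(G)^k$, $G\oplus_{\bar a}A$ is the digraph on $V(G)$ with arc $\vec{uv}$ ($u\neq v$) iff $[uv\in E(G)]$ xor $[(\mathrm{atp}(u,\bar a),\mathrm{atp}(v,\bar a))\in A]$. For a digraph $H$, $\mathrm{Suffixes}(H)=\{S\subseteq V(H):$ for every arc $\vec{uv}$ of $H$, $u\in S$ implies $v\in S\}$. -}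

module Defs where

open import Data.Nat using (ℕ; zero; suc; _≤_; _<_)
open import Data.Fin using (Fin; zero; suc; _≟_)
open import Data.Bool using (Bool; true; false; _∧_; _xor_; not)
open import Data.Product using (Σ; ∃; ∃-syntax; _×_; _,_)
open import Relation.Binary.PropositionalEquality using (_≡_; _≢_)
open import Relation.Nullary using (Dec; yes; no; does)

record Graph (c : ℕ) : Set where
  field
    n      : ℕ
    E      : Fin n → Fin n → Bool
    E-sym  : ∀ u v → E u v ≡ E v u
    E-irr  : ∀ v → E v v ≡ false
    U      : Fin c → Fin n → Bool

open Graph public

VSet : ∀ {c} → Graph c → Set
VSet G = Fin (n G) → Bool

xorSum : (m : ℕ) → (Fin m → Bool) → Bool
xorSum zero    f = false
xorSum (suc m) f = f zero xor xorSum m (λ i → f (suc i))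

-- Adjacency matrix between X (rows) and V(G) \ X (columns), over F₂.
RowsIndependent : ∀ {c} (G : Graph c) (X : VSet G) (m : ℕ) → (Fin m → Fin (n G)) → Set
RowsIndependent G X m f =
  (∀ i → X (f i) ≡ true) ×
  (∀ (coef : Fin m → Bool) →
     (∀ y → X y ≡ false → xorSum m (λ i → coef i ∧ E G (f i) y) ≡ false) →
     ∀ i → coef i ≡ false)

RankLe : ∀ {c} (G : Graph c) → ℕ → VSet G → Set
RankLe G r X = ∀ (m : ℕ) (f : Fin m → Fin (n G)) → RowsIndependent G X m f → m ≤ r

LowRank : ∀ {c} (r : ℕ) (G : Graph c) → VSet G → Set
LowRank r G X = RankLe G r X

data AtomicFormula (c m : ℕ) : Set where
  eqA   : Fin m → Fin m → AtomicFormula c m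
  edgeA : Fin m → Fin m → AtomicFormula c m
  unA   : Fin c → Fin m → AtomicFormula c m

AtomicType : ℕ → ℕ → Set
AtomicType c m = AtomicFormula c m → Bool

atp : ∀ {c m} (G : Graph c) → (Fin m → Fin (n G)) → AtomicType c m
atp G t (eqA i j)   = does (t i ≟ t j)
atp G t (edgeA i j) = E G (t i) (t j)
atp G t (unA p i)   = U G p (t i)

cons : ∀ {A : Set} {k} → A → (Fin k → A) → Fin (suc k) → A
cons u a zero    = u
cons u a (suc i) = a i

Arc : ∀ {c k} (G : Graph c) (a : Fin k → Fin (n G))
      (A : AtomicType c (suc k) → AtomicType c (suc k) → Bool) →
      Fin (n G) → Fin (n G) → Set
Arc G a A u v = u ≢ v × ((E G u v xor A (atp G (cons u a)) (atp G (cons v a))) ≡ true)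

Suffix : ∀ {c k} (G : Graph c) (a : Fin k → Fin (n G))
         (A : AtomicType c (suc k) → AtomicType c (suc k) → Bool) → VSet G → Set
Suffix G a A S = ∀ u v → Arc G a A u v → S u ≡ true → S v ≡ true

-- Let ā = x̄ ȳ with x̄, ȳ ∈ V(G)ʳ. The atomic type τ of (u, ā) records the bits E(xᵢ, y_j) and
-- E(u, y_j); A(τ, σ) picks some l ∈ F₂ʳ with Σᵢ lᵢ E(xᵢ, y_j) = E(u, y_j) for all j and predicts
-- the edge uv as Σᵢ lᵢ E(xᵢ, v), read off the type σ of (v, ā). X is a suffix of G ⊕_ā A iff
-- this prediction is correct for all u ∈ X and v ∉ X.
-- If rk(X) ≤ r, let x̄ span the rows of the X × (V∖X) matrix and let ȳ ∉ X span the columns of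
-- the r × (V∖X) matrix of x̄. Two solutions l then agree on the columns ȳ, hence on all of
-- V∖X, and one of them is the expansion of the row of u, so every prediction is correct.
-- Conversely, correct predictions make each row of X over V∖X a combination of r fixed vectors
-- with coefficients l(u) ∈ F₂ʳ, and more than r vectors of F₂ʳ are dependent.

module Submission where

open import Defs
open import Data.Nat using (ℕ; zero; suc; _+_; _≤_; _<_; z≤n; s≤s)
open import Data.Nat.Properties using (+-suc; +-identityʳ; m≤n+m; <-irrefl; ≤-trans; ≤-reflexive)
open import Data.Fin using (Fin; zero; suc; punchOut; _↑ˡ_; _↑ʳ_; fromℕ<)
import Data.Fin as Fin
open import Data.Fin.Properties using (any?; all?; punchIn-punchOut)
open import Data.Fin.Subset.Properties using (anySubset?)
open import Data.Bool using (Bool; true; false; not; _∧_; _xor_; _≟_)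
open import Data.Bool.Properties
  using (xor-∧-commutativeRing; ∧-commutativeMonoid; ∧-comm; ∧-assoc; ∧-zeroʳ; ∧-identityʳ;
         ∧-distribˡ-xor; xor-comm; xor-same; ¬-not; not-¬)
open import Data.Vec using (lookup; tabulate)
open import Data.Vec.Properties using (lookup∘tabulate)
open import Data.Vec.Functional using (Vector; removeAt; _++_)
open import Data.Vec.Functional.Properties using (lookup-++ˡ; lookup-++ʳ)
open import Data.Product using (Σ; ∃; ∃-syntax; _×_; _,_; proj₁; proj₂)
open import Function using (_∘_; const)
open import Algebra.Bundles using (CommutativeRing; CommutativeMonoid)
open import Relation.Binary.PropositionalEquality
open import Relation.Nullary using (Dec; yes; no; ¬_; contradiction)
open import Relation.Nullary.Decidable using (map′; _×-dec_; ¬?; decidable-stable)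
open import Relation.Unary using (Decidable)

open CommutativeRing xor-∧-commutativeRing using (semiring)
open import Algebra.Properties.Semiring.Sum semiring
  using (sum; sum-cong-≗; sum-replicate-zero; ∑-comm; ∑-distrib-+; *-distribˡ-sum; *-distribʳ-sum)
open import Algebra.Properties.CommutativeSemigroup
  (CommutativeMonoid.commutativeSemigroup ∧-commutativeMonoid) using (x∙yz≈y∙xz)
open ≡-Reasoning

infix 7 _·_

_·_ : ∀ {m} → Vector Bool m → Vector Bool m → Bool
u · v = sum (λ i → u i ∧ v i)

lincomb : ∀ {m D} → Vector Bool m → (Fin m → Vector Bool D) → Vector Bool D
lincomb l v d = l · (λ i → v i d)

Independent : ∀ {m D} → (Fin m → Vector Bool D) → Set
Independent v = ∀ l → lincomb l v ≗ const false → l ≗ const false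

InSpan : ∀ {m D} → (Fin m → Vector Bool D) → Vector Bool D → Set
InSpan v w = ∃ λ l → w ≗ lincomb l v

xorSum≡sum : ∀ m (f : Fin m → Bool) → xorSum m f ≡ sum f
xorSum≡sum zero    f = refl
xorSum≡sum (suc m) f = cong (f zero xor_) (xorSum≡sum m (f ∘ suc))

xor≡false⇒≡ : ∀ {a b} → a xor b ≡ false → a ≡ b
xor≡false⇒≡ {true}  {true}  _ = refl
xor≡false⇒≡ {false} {false} _ = refl

·-congˡ : ∀ {m} {u u′ : Vector Bool m} v → u ≗ u′ → u · v ≡ u′ · v
·-congˡ v u≗u′ = sum-cong-≗ (λ i → cong (_∧ v i) (u≗u′ i))

·-congʳ : ∀ {m} u {v v′ : Vector Bool m} → v ≗ v′ → u · v ≡ u · v′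
·-congʳ u v≗v′ = sum-cong-≗ (λ i → cong (u i ∧_) (v≗v′ i))

·-comm : ∀ {m} (u v : Vector Bool m) → u · v ≡ v · u
·-comm u v = sum-cong-≗ (λ i → ∧-comm (u i) (v i))

·-zeroʳ : ∀ {m} (u : Vector Bool m) → u · const false ≡ false
·-zeroʳ {m} u = trans (sum-cong-≗ (λ i → ∧-zeroʳ (u i))) (sum-replicate-zero m)

·-adjoint : ∀ {m D} (a : Vector Bool m) (b : Vector Bool D) (M : Fin m → Vector Bool D) →
            a · (λ j → b · M j) ≡ b · lincomb a M
·-adjoint a b M = begin
  sum (λ j → a j ∧ sum (λ i → b i ∧ M j i))
    ≡⟨ sum-cong-≗ (λ j → *-distribˡ-sum (a j) (λ i → b i ∧ M j i)) ⟩
  sum (λ j → sum (λ i → a j ∧ (b i ∧ M j i)))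
    ≡⟨ ∑-comm (λ j i → a j ∧ (b i ∧ M j i)) ⟩
  sum (λ i → sum (λ j → a j ∧ (b i ∧ M j i)))
    ≡⟨ sum-cong-≗ (λ i → sum-cong-≗ (λ j → x∙yz≈y∙xz (a j) (b i) (M j i))) ⟩
  sum (λ i → sum (λ j → b i ∧ (a j ∧ M j i)))
    ≡⟨ sum-cong-≗ (λ i → *-distribˡ-sum (b i) (λ j → a j ∧ M j i)) ⟨
  sum (λ i → b i ∧ sum (λ j → a j ∧ M j i))
    ∎

·-agrees-on-span : ∀ {m D} {L l : Vector Bool D} {c : Fin m → Vector Bool D} {w : Vector Bool D} →
                   (∀ j → L · c j ≡ l · c j) → InSpan c w → L · w ≡ l · w
·-agrees-on-span {L = L} {l} {c} {w} agree (ν , w≗νc) = begin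
  L · w                    ≡⟨ ·-congʳ L w≗νc ⟩
  L · lincomb ν c          ≡⟨ ·-adjoint ν L c ⟨
  ν · (λ j → L · c j)      ≡⟨ ·-congʳ ν agree ⟩
  ν · (λ j → l · c j)      ≡⟨ ·-adjoint ν l c ⟩
  l · lincomb ν c          ≡⟨ ·-congʳ l w≗νc ⟨
  l · w                    ∎

clearWith : ∀ {D} → Vector Bool D → Fin D → Vector Bool D → Vector Bool D
clearWith pivot p v e = v e xor (v p ∧ pivot e)

lincomb-clearWith : ∀ {m D} (l : Vector Bool m) (v : Fin m → Vector Bool D) pivot p e →
  lincomb l (λ i → clearWith pivot p (v i)) e ≡ lincomb l v e xor (lincomb l v p ∧ pivot e)
lincomb-clearWith l v pivot p e = begin
  sum (λ i → l i ∧ (v i e xor (v i p ∧ pivot e)))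
    ≡⟨ sum-cong-≗ (λ i → distrib (l i) (v i e) (v i p) (pivot e)) ⟩
  sum (λ i → (l i ∧ v i e) xor ((l i ∧ v i p) ∧ pivot e))
    ≡⟨ ∑-distrib-+ (λ i → l i ∧ v i e) (λ i → (l i ∧ v i p) ∧ pivot e) ⟩
  lincomb l v e xor sum (λ i → (l i ∧ v i p) ∧ pivot e)
    ≡⟨ cong (lincomb l v e xor_) (*-distribʳ-sum (pivot e) (λ i → l i ∧ v i p)) ⟨
  lincomb l v e xor (lincomb l v p ∧ pivot e)
    ∎
  where
  distrib : ∀ c a b z → c ∧ (a xor (b ∧ z)) ≡ (c ∧ a) xor ((c ∧ b) ∧ z)
  distrib c a b z = trans (∧-distribˡ-xor c a (b ∧ z)) (cong ((c ∧ a) xor_) (sym (∧-assoc c b z)))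

removeAt-vanishes⇒vanishes : ∀ {D} {w : Vector Bool (suc D)} {p} →
                             w p ≡ false → removeAt w p ≗ const false → w ≗ const false
removeAt-vanishes⇒vanishes {w = w} {p} wp≡0 rest≡0 e with e Fin.≟ p
... | yes refl = wp≡0
... | no e≢p   = trans (cong w (sym (punchIn-punchOut p≢e))) (rest≡0 (punchOut p≢e))
  where p≢e = e≢p ∘ sym

independent-head-nonzero : ∀ {m D} {v : Fin (suc m) → Vector Bool D} →
                           Independent v → ¬ (v zero ≗ const false)
independent-head-nonzero {m} {v = v} v-indep v₀≗0 = contradiction (v-indep e₀ e₀v-vanishes zero) λ ()
  where
  e₀ : Vector Bool (suc m)
  e₀ = cons true (const false)
  e₀v-vanishes : lincomb e₀ v ≗ const false
  e₀v-vanishes d = cong₂ _xor_ (v₀≗0 d) (sum-replicate-zero m)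

independent-clearWith : ∀ {m D} {v : Fin (suc m) → Vector Bool (suc D)} {p} →
                        Independent v → v zero p ≡ true →
                        Independent (λ i → removeAt (clearWith (v zero) p (v (suc i))) p)
independent-clearWith {m} {D} {v} {p} v-indep v₀p≡1 c c-vanishes i = v-indep coef coef-vanishes (suc i)
  where
  cleared : Fin m → Vector Bool (suc D)
  cleared i = clearWith (v zero) p (v (suc i))
  coef : Vector Bool (suc m)
  coef = cons (lincomb c (v ∘ suc) p) c
  cleared-at-pivot : ∀ i → cleared i p ≡ false
  cleared-at-pivot i = begin
    v (suc i) p xor (v (suc i) p ∧ v zero p) ≡⟨ cong (λ b → v (suc i) p xor (v (suc i) p ∧ b)) v₀p≡1 ⟩
    v (suc i) p xor (v (suc i) p ∧ true)     ≡⟨ cong (v (suc i) p xor_) (∧-identityʳ (v (suc i) p)) ⟩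
    v (suc i) p xor v (suc i) p              ≡⟨ xor-same (v (suc i) p) ⟩
    false                                    ∎
  combination-vanishes : lincomb c cleared ≗ const false
  combination-vanishes =
    removeAt-vanishes⇒vanishes (trans (·-congʳ c cleared-at-pivot) (·-zeroʳ c)) c-vanishes
  coef-vanishes : lincomb coef v ≗ const false
  coef-vanishes e = begin
    (lincomb c (v ∘ suc) p ∧ v zero e) xor lincomb c (v ∘ suc) e
      ≡⟨ xor-comm (lincomb c (v ∘ suc) p ∧ v zero e) (lincomb c (v ∘ suc) e) ⟩
    lincomb c (v ∘ suc) e xor (lincomb c (v ∘ suc) p ∧ v zero e)
      ≡⟨ lincomb-clearWith c (v ∘ suc) (v zero) p e ⟨
    lincomb c cleared e
      ≡⟨ combination-vanishes e ⟩
    false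
      ∎

-- Gaussian elimination: pivot on a nonzero entry p of v₀, then drop coordinate p.
independent⇒≤dim : ∀ {m D} (v : Fin m → Vector Bool D) → Independent v → m ≤ D
independent⇒≤dim {zero} v _ = z≤n
independent⇒≤dim {suc m} v v-indep with any? (λ p → v zero p ≟ true)
... | no v₀≢1 =
  contradiction (λ p → ¬-not {y = true} (v₀≢1 ∘ (p ,_))) (independent-head-nonzero {v = v} v-indep)
independent⇒≤dim {suc m} {zero}  v v-indep | yes (() , _)
independent⇒≤dim {suc m} {suc D} v v-indep | yes (p , v₀p≡1) =
  s≤s (independent⇒≤dim (λ i → removeAt (clearWith (v zero) p (v (suc i))) p)
                        (independent-clearWith {v = v} v-indep v₀p≡1))

any-vector? : ∀ {r} {P : Vector Bool r → Set} →
              (∀ {u v} → u ≗ v → P u → P v) → Decidable P → Dec (∃ P)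
any-vector? resp P? = map′ (λ (s , p) → lookup s , p)
                           (λ (l , p) → tabulate l , resp (sym ∘ lookup∘tabulate l) p)
                           (anySubset? (P? ∘ lookup))

choose : ∀ {r} {P : Vector Bool r → Set} → Dec (∃ P) → Vector Bool r
choose (yes (l , _)) = l
choose (no _)        = const false

choose-satisfies : ∀ {r} {P : Vector Bool r → Set} (P? : Dec (∃ P)) → ∃ P → P (choose P?)
choose-satisfies (yes (_ , Pl)) _  = Pl
choose-satisfies (no ¬∃P)       ∃P = contradiction ∃P ¬∃P

inSpan? : ∀ {m D} (v : Fin m → Vector Bool D) w → Dec (InSpan v w)
inSpan? v w = any-vector? (λ l≗l′ w≗lv d → trans (w≗lv d) (·-congˡ (λ i → v i d) l≗l′))
                          (λ l → all? (λ d → w d ≟ lincomb l v d))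

independent-cons : ∀ {m D} {v : Fin m → Vector Bool D} {w} →
                   Independent v → ¬ InSpan v w → Independent (cons w v)
independent-cons {v = v} {w} v-indep w∉span l lv≗0 = coefficients-vanish
  where
  combination : ∀ {b} → l zero ≡ b → ∀ d → (b ∧ w d) xor lincomb (l ∘ suc) v d ≡ false
  combination {b} l₀≡b d = subst (λ b → (b ∧ w d) xor lincomb (l ∘ suc) v d ≡ false) l₀≡b (lv≗0 d)
  head-vanishes : l zero ≡ false
  head-vanishes = ¬-not {y = true} λ l₀≡1 → w∉span (l ∘ suc , xor≡false⇒≡ ∘ combination l₀≡1)
  coefficients-vanish : l ≗ const false
  coefficients-vanish zero    = head-vanishes
  coefficients-vanish (suc i) = v-indep (l ∘ suc) (combination head-vanishes) i

record Spanning {n D} (vec : Fin n → Vector Bool D) (C : Fin n → Set) (s : ℕ) : Set where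
  field
    family   : Fin s → Fin n
    family∈C : ∀ i → C (family i)
    spans   : ∀ u → C u → InSpan (vec ∘ family) (vec u)

pad : ∀ {A : Set} {s r} → s ≤ r → Vector A s → A → Vector A r
pad z≤n       x d i       = d
pad (s≤s s≤r) x d zero    = x zero
pad (s≤s s≤r) x d (suc i) = pad s≤r (x ∘ suc) d i

pad-preserves : ∀ {A : Set} (P : A → Set) {s r} (s≤r : s ≤ r) {x d} →
                (∀ i → P (x i)) → P d → ∀ i → P (pad s≤r x d i)
pad-preserves P z≤n       Px Pd i       = Pd
pad-preserves P (s≤s s≤r) Px Pd zero    = Px zero
pad-preserves P (s≤s s≤r) Px Pd (suc i) = pad-preserves P s≤r (Px ∘ suc) Pd i

·-pad : ∀ {A : Set} {s r} (s≤r : s ≤ r) (l : Vector Bool s) (x : Vector A s) d (g : A → Bool) →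
        pad s≤r l false · (g ∘ pad s≤r x d) ≡ l · (g ∘ x)
·-pad {r = r} z≤n l x d g = sum-replicate-zero r
·-pad (s≤s s≤r) l x d g   = cong ((l zero ∧ g (x zero)) xor_) (·-pad s≤r (l ∘ suc) (x ∘ suc) d g)

spanning-pad : ∀ {n D s r} {vec : Fin n → Vector Bool D} {C : Fin n → Set} {d} →
               s ≤ r → C d → Spanning vec C s → Spanning vec C r
spanning-pad {vec = vec} {C} {d} s≤r d∈C S = record
  { family   = pad s≤r family d
  ; family∈C = pad-preserves C s≤r family∈C d∈C
  ; spans    = λ u u∈C → let (l , u≗lx) = spans u u∈C in
      pad s≤r l false , λ e → trans (u≗lx e) (sym (·-pad s≤r l family d (λ x → vec x e)))
  }
  where open Spanning S

module _ {n D r : ℕ} (vec : Fin n → Vector Bool D) {C : Fin n → Set} (C? : Decidable C)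
         (bound : ∀ {s} (x : Fin s → Fin n) → (∀ i → C (x i)) → Independent (vec ∘ x) → s ≤ r) where

  private
    grow : ∀ f {s} (x : Fin s → Fin n) → (∀ i → C (x i)) → Independent (vec ∘ x) → f + s ≡ r →
           Σ ℕ λ t → t ≤ r × Spanning vec C t
    grow f {s} x x∈C x-indep f+s≡r with any? (λ u → C? u ×-dec ¬? (inSpan? (vec ∘ x) (vec u)))
    ... | no x-spans = s , ≤-trans (m≤n+m s f) (≤-reflexive f+s≡r) , record
      { family = x ; family∈C = x∈C
      ; spans = λ u u∈C → decidable-stable (inSpan? (vec ∘ x) (vec u)) λ u∉span → x-spans (u , u∈C , u∉span)
      }
    ... | yes (u , u∈C , u∉span) = continue f f+s≡r
      where
      ux∈C : ∀ i → C (cons u x i)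
      ux∈C zero    = u∈C
      ux∈C (suc i) = x∈C i
      ux-indep : Independent (vec ∘ cons u x)
      ux-indep = independent-cons x-indep u∉span
      continue : ∀ f → f + s ≡ r → Σ ℕ λ t → t ≤ r × Spanning vec C t
      continue zero    s≡r   = contradiction (bound (cons u x) ux∈C ux-indep) (<-irrefl s≡r)
      continue (suc f) f+s≡r = grow f (cons u x) ux∈C ux-indep (trans (+-suc f s) f+s≡r)

  spanning-family : ∀ {d} → C d → Spanning vec C r
  spanning-family d∈C =
    let (s , s≤r , S) = grow r (λ ()) (λ ()) (λ _ _ ()) (+-identityʳ r) in spanning-pad s≤r d∈C S

CrossingEdgesPredicted : ∀ {c k} (G : Graph c) (a : Fin k → Fin (n G))
  (A : AtomicType c (suc k) → AtomicType c (suc k) → Bool) → VSet G → Set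
CrossingEdgesPredicted G a A X =
  ∀ {u v} → X u ≡ true → X v ≡ false → E G u v ≡ A (atp G (cons u a)) (atp G (cons v a))

module _ {c k} {G : Graph c} {a : Fin k → Fin (n G)} {A : AtomicType c (suc k) → AtomicType c (suc k) → Bool}
         {X : VSet G} where

  suffix⇒crossingEdgesPredicted : Suffix G a A X → CrossingEdgesPredicted G a A X
  suffix⇒crossingEdgesPredicted suffix {u} {v} u∈X v∉X = xor≡false⇒≡ (¬-not {y = true} no-arc)
    where
    u≢v : u ≢ v
    u≢v refl = not-¬ u∈X v∉X
    no-arc : (E G u v xor A (atp G (cons u a)) (atp G (cons v a))) ≢ true
    no-arc arc = not-¬ (suffix u v (u≢v , arc) u∈X) v∉X

  crossingEdgesPredicted⇒suffix : CrossingEdgesPredicted G a A X → Suffix G a A X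
  crossingEdgesPredicted⇒suffix predicted u v (_ , arc) u∈X with X v in eq
  ... | true  = refl
  ... | false = contradiction (begin
    E G u v xor A τu τv  ≡⟨ cong (_xor A τu τv) (predicted u∈X eq) ⟩
    A τu τv xor A τu τv  ≡⟨ xor-same (A τu τv) ⟩
    false                ∎) (not-¬ arc)
    where
    τu = atp G (cons u a)
    τv = atp G (cons v a)

module CutRelation (c r : ℕ) where

  k : ℕ
  k = r + r

  xpos ypos : Fin r → Fin k
  xpos i = i ↑ˡ r
  ypos j = r ↑ʳ j

  -- For τ the type of (u, x̄, ȳ): l expresses the adjacencies of u to ȳ through those of x̄.
  Solves : AtomicType c (suc k) → Vector Bool r → Set
  Solves τ l = ∀ j → l · (λ i → τ (edgeA (suc (xpos i)) (suc (ypos j)))) ≡ τ (edgeA zero (suc (ypos j)))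

  solution? : ∀ τ → Dec (∃ (Solves τ))
  solution? τ = any-vector? {P = Solves τ}
    (λ l≗l′ l-solves j → trans (·-congˡ _ (sym ∘ l≗l′)) (l-solves j))
    (λ l → all? (λ j → _ ≟ _))

  coefficients : AtomicType c (suc k) → Vector Bool r
  coefficients τ = choose (solution? τ)

  coefficients-solve : ∀ {τ l} → Solves τ l → Solves τ (coefficients τ)
  coefficients-solve {τ} {l} l-solves = choose-satisfies (solution? τ) (l , l-solves)

  predictedEdge : AtomicType c (suc k) → AtomicType c (suc k) → Bool
  predictedEdge τ σ = coefficients τ · (λ i → σ (edgeA zero (suc (xpos i))))

  suffix⇒lowRank : ∀ (G : Graph c) a X → Suffix G a predictedEdge X → LowRank r G X
  suffix⇒lowRank G a X suffix m f (f∈X , f-indep) = independent⇒≤dim w w-indep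
    where
    predicted : CrossingEdgesPredicted G a predictedEdge X
    predicted = suffix⇒crossingEdgesPredicted {G = G} {a} {predictedEdge} suffix
    w : Fin m → Vector Bool r
    w j = coefficients (atp G (cons (f j) a))
    b : Fin (n G) → Vector Bool r
    b y i = E G y (a (xpos i))
    w-indep : Independent w
    w-indep l lw≗0 = f-indep l λ y y∉X → begin
      xorSum m (λ j → l j ∧ E G (f j) y)  ≡⟨ xorSum≡sum m _ ⟩
      l · (λ j → E G (f j) y)             ≡⟨ ·-congʳ l (λ j → predicted (f∈X j) y∉X) ⟩
      l · (λ j → w j · b y)               ≡⟨ ·-congʳ l (λ j → ·-comm (w j) (b y)) ⟩
      l · (λ j → b y · w j)               ≡⟨ ·-adjoint l (b y) w ⟩
      b y · lincomb l w                   ≡⟨ ·-congʳ (b y) lw≗0 ⟩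
      b y · const false                   ≡⟨ ·-zeroʳ (b y) ⟩
      false                               ∎

  module SpanningTuple (G : Graph c) (X : VSet G) (low : LowRank r G X)
                       {u₀} (u₀∈X : X u₀ ≡ true) {w₀} (w₀∉X : X w₀ ≡ false) where

    -- the row of u in the X × (V∖X) adjacency matrix, extended by zeros on X
    cutRow : Fin (n G) → Vector Bool (n G)
    cutRow u z = not (X z) ∧ E G u z

    cutRow-outside : ∀ {u z} → X z ≡ false → cutRow u z ≡ E G u z
    cutRow-outside {u} {z} z∉X = cong (λ b → not b ∧ E G u z) z∉X

    cutRows-bounded : ∀ {s} (x : Fin s → Fin (n G)) → (∀ i → X (x i) ≡ true) →
                      Independent (cutRow ∘ x) → s ≤ r
    cutRows-bounded {s} x x∈X x-indep = low s x (x∈X , λ l → x-indep l ∘ vanishes l)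
      where
      vanishes : ∀ l → (∀ z → X z ≡ false → xorSum s (λ i → l i ∧ E G (x i) z) ≡ false) →
                 lincomb l (cutRow ∘ x) ≗ const false
      vanishes l l-vanishes z with X z in Xz
      ... | true  = ·-zeroʳ l
      ... | false = trans (sym (xorSum≡sum s _)) (l-vanishes z Xz)

    rows : Spanning cutRow (λ u → X u ≡ true) r
    rows = spanning-family cutRow (λ u → X u ≟ true) cutRows-bounded u₀∈X

    x : Fin r → Fin (n G)
    x = Spanning.family rows

    col : Fin (n G) → Vector Bool r
    col z i = E G (x i) z

    row-expansion : ∀ {u} → X u ≡ true → ∃ λ l → ∀ {z} → X z ≡ false → E G u z ≡ l · col z
    row-expansion {u} u∈X with Spanning.spans rows u u∈X
    ... | l , u≗lx = l , λ {z} z∉X → begin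
      E G u z                   ≡⟨ cutRow-outside z∉X ⟨
      cutRow u z                ≡⟨ u≗lx z ⟩
      lincomb l (cutRow ∘ x) z  ≡⟨ ·-congʳ l (λ i → cutRow-outside z∉X) ⟩
      l · col z                 ∎

    columns : Spanning col (λ v → X v ≡ false) r
    columns = spanning-family col (λ v → X v ≟ false) (λ y _ → independent⇒≤dim (col ∘ y)) w₀∉X

    y : Fin r → Fin (n G)
    y = Spanning.family columns

    ā : Fin k → Fin (n G)
    ā = x ++ y

    -- L and the row expansion l of u agree on the columns at ȳ, which span all columns outside X.
    crossing : CrossingEdgesPredicted G ā predictedEdge X
    crossing {u} {v} u∈X v∉X = begin
      E G u v                    ≡⟨ expand v∉X ⟩
      l · col v                  ≡⟨ ·-agrees-on-span agree (Spanning.spans columns v v∉X) ⟨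
      L · col v                  ≡⟨ ·-congʳ L xv-entry ⟩
      predictedEdge τ (atp G (cons v ā)) ∎
      where
      τ = atp G (cons u ā)
      L = coefficients τ
      l = proj₁ (row-expansion u∈X)
      expand : ∀ {z} → X z ≡ false → E G u z ≡ l · col z
      expand = proj₂ (row-expansion u∈X)
      y∉X : ∀ j → X (y j) ≡ false
      y∉X = Spanning.family∈C columns
      xy-entry : ∀ i j → τ (edgeA (suc (xpos i)) (suc (ypos j))) ≡ col (y j) i
      xy-entry i j = cong₂ (E G) (lookup-++ˡ x y i) (lookup-++ʳ x y j)
      uy-entry : ∀ j → τ (edgeA zero (suc (ypos j))) ≡ E G u (y j)
      uy-entry j = cong (E G u) (lookup-++ʳ x y j)
      xv-entry : ∀ i → col v i ≡ E G v (ā (xpos i))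
      xv-entry i = trans (E-sym G (x i) v) (cong (E G v) (sym (lookup-++ˡ x y i)))
      l-solves : Solves τ l
      l-solves j = trans (·-congʳ l (λ i → xy-entry i j))
                         (trans (sym (expand (y∉X j))) (sym (uy-entry j)))
      agree : ∀ j → L · col (y j) ≡ l · col (y j)
      agree j = trans (sym (·-congʳ L (λ i → xy-entry i j)))
                      (trans (coefficients-solve {τ} {l} l-solves j)
                             (trans (uy-entry j) (expand (y∉X j))))

  lowRank⇒suffix : ∀ (G : Graph c) → Fin (n G) → ∀ X → LowRank r G X → ∃[ a ] Suffix G a predictedEdge X
  lowRank⇒suffix G v₀ X low with any? (λ u → X u ≟ true) | any? (λ w → X w ≟ false)
  ... | yes (_ , u₀∈X) | yes (_ , w₀∉X) =
    ā , crossingEdgesPredicted⇒suffix {G = G} {ā} {predictedEdge} crossing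
    where open SpanningTuple G X low u₀∈X w₀∉X
  ... | no X-empty | _         = const v₀ , λ u _ _ u∈X → contradiction (u , u∈X) X-empty
  ... | yes _      | no X-full = const v₀ , λ _ v _ _ → ¬-not {y = false} (X-full ∘ (v ,_))

lemma6p2 : (c r : ℕ) →
    ∃[ k ] Σ (AtomicType c (suc k) → AtomicType c (suc k) → Bool) λ A →
      ∀ (G : Graph c) → 0 < n G → ∀ (X : VSet G) →
        (LowRank r G X → ∃[ a ] Suffix {k = k} G a A X) ×
        ((∃[ a ] Suffix {k = k} G a A X) → LowRank r G X)
lemma6p2 c r = k , predictedEdge , λ G 0<n X →
  lowRank⇒suffix G (fromℕ< 0<n) X , λ (a , suffix) → suffix⇒lowRank G a X suffix
  where open CutRelation c r
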